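{- Let $r\ge 1$, let $N$ and $N'$ be two networks with $n$ boundary vertices and the same excedance $k$, and let $\lambda=(\lambda_1,\dots,\lambda_n)$ be integers with $0\le\lambda_i\le r$ and $\lambda_1+\cdots+\lambda_n=kr$. If $\tilde X(N)=\tilde X(N')$, then $\mathrm{Web}_r(N;\lambda)=\mathrm{Web}_r(N';\lambda)$ as elements of $\mathcal W_\lambda(U)$.
   Context: Networks. A network $N$ is a finite planar bipartite graph $G$ embedded in a closed disk (vertices colored black and white, every edge joining vertices of different colors), together with a nonzero complex weight $\mathrm{wt}(e)$ on each edge. There are $n$ boundary vertices on the boundary circle, labeled $1,\dots,n$ counterclockwise; all boundary vertices are black, and boundary vertex $i$ is incident to at most one edge, called $b_i$. The other vertices are interior. A dimer configuration (almost perfect matching) $\pi$ is a set of edges such that every interior vertex lies on exactly one edge of $\pi$ and every boundary vertex lies on at most one; $\partial(\pi)\subset[n]$ is the set of boundary vertices used by $\pi$. Its cardinality $k$, the excedance of $N$, equals the number of interior white vertices minus the number of interior black vertices. Set $\mathrm{wt}(\pi)=\prod_{e\in\pi}\mathrm{wt}(e)$ and, for $I\in\binom{[n]}{k}$, $\Delta_I(N)=\sum_{\pi:\partial(\pi)=I}\mathrm{wt}(\pi)$. Standing assumption: every network considered has at least one almost perfect matching. $\tilde X(N)=(\Delta_I(N))_{I}\in\mathbb C^{\binom nk}$ (a point of the affine cone over $\mathrm{Gr}(k,n)$ in its Plücker embedding). Tensor invariants. $U=\mathbb C^r$ with basis $E_1,\dots,E_r$, and $\bigwedge^rU\cong\mathbb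 C$ via $E_1\wedge\cdots\wedge E_r\mapsto1$. $\mathcal W_\lambda(U)=\mathrm{Hom}_{\mathrm{SL}(U)}(\bigotimes_{i=1}^n\bigwedge^{\lambda_i}U,\mathbb C)$. For $S\subset[r]$, $E_S$ is the wedge of the $E_i$, $i\in S$, in increasing order. A list of boundary label subsets of type $\lambda$ is $\mathcal S=(S_1,\dots,S_n)$ with $S_j\subset[r]$, $|S_j|=\lambda_j$, and every $i\in[r]$ lying in exactly $k$ of the $S_j$; put $E_{\mathcal S}=E_{S_1}\otimes\cdots\otimes E_{S_n}$, and $\mathrm{sign}(\mathcal S)=(-1)^{\mathrm{inv}}$ where $\mathrm{inv}$ is the number of pairs $p<q$ with $w_p>w_q$ in the word $w$ obtained by concatenating the increasing listings of $S_1,\dots,S_n$. Weblike subgraphs. An $r$-weblike subgraph $W$ of $G$ is a set of edges of $G$ with multiplicities $m(e)\in[r]$ such that at every interior vertex the multiplicities of the incident edges of $W$ sum to $r$. Its weight is $\mathrm{wt}(W)=\prod_{e\in W}\mathrm{wt}(e)^{m(e)}$ and its degree is $\lambda(W)=(m(b_1),\dots,m(b_n))$ (with $m(b_j)=0$ if $b_j\notin W$ or does not exist). A consistent labeling of $W$ assigns to each $e\in W$ a set $S(e)\subset[r]$ with $|S(e)|=m(e)$ such that at each interior vertex the sets on the incident edges are pairwise disjoint with union $[r]$. $a(\mathcal S;W)$ denotes the number of consistent labelings with $S(b_j)=S_j$ for all $j$ (where $S(b_j)=\emptyset$ if $b_j\notin W$). For $W$ of degree $\lambda$, $\mathbf W\in\mathcal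 W_\lambda(U)$ denotes the unique element with $\mathbf W(E_{\mathcal S})=\mathrm{sign}(\mathcal S)\,a(\mathcal S;W)$ for every list $\mathcal S$ of type $\lambda$ (such an element exists and is unique). Finally $\mathrm{Web}_r(N;\lambda)=\sum_{W:\lambda(W)=\lambda}\mathrm{wt}(W)\,\mathbf W\in\mathcal W_\lambda(U)$, the sum over $r$-weblike subgraphs of $G$ of degree $\lambda$. -}

module Defs where

open import Level using (0ℓ)
open import Algebra.Bundles using (CommutativeRing)
open import Data.Nat as ℕ using (ℕ; zero; suc; _≤_; _<?_)
import Data.Nat.Properties as ℕP
open import Data.Bool using (Bool; true; false; if_then_else_; _∧_; _∨_; not)
open import Data.Fin as Fin using (Fin; toℕ; fromℕ<)
import Data.Fin.Properties as FinP
open import Data.Vec as Vec using (Vec; lookup)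
open import Data.List as List using (List; []; _∷_; _++_; concatMap; allFin; foldr; filter)
open import Data.Product using (Σ; ∃; ∃-syntax; _×_; _,_; proj₁)
open import Data.Sum using (_⊎_; inj₁; inj₂)
open import Data.Empty using (⊥)
open import Relation.Nullary using (¬_; yes; no)
open import Relation.Nullary.Decidable using (⌊_⌋)
open import Relation.Binary.PropositionalEquality using (_≡_)
open import Function.Bundles using (_⇔_)

module _ (R : CommutativeRing 0ℓ 0ℓ) where
  open CommutativeRing R

  fromℕ : ℕ → Carrier
  fromℕ zero    = 0#
  fromℕ (suc n) = 1# + fromℕ n

  evalPoly : List Carrier → Carrier → Carrier
  evalPoly []       x = 0#
  evalPoly (c ∷ cs) x = c + x * evalPoly cs x

record ACF0 : Set₁ where
  field
    cring : CommutativeRing 0ℓ 0ℓ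
  open CommutativeRing cring public
  field
    1≉0       : ¬ (1# ≈ 0#)
    inverse   : ∀ x → ¬ (x ≈ 0#) → ∃[ y ] (x * y ≈ 1#)
    char0     : ∀ n → ¬ (fromℕ cring (suc n) ≈ 0#)
    -- every monic polynomial c₀ + c₁x + … + c_{d-1}x^{d-1} + x^d, d ≥ 1, has a root
    algClosed : ∀ (c : Carrier) (cs : List Carrier) →
                ∃[ x ] (evalPoly cring (c ∷ cs List.++ (1# ∷ [])) x ≈ 0#)

count : ∀ {m} → (Fin m → Bool) → ℕ
count {zero}  p = 0
count {suc m} p = (if p Fin.zero then 1 else 0) ℕ.+ count (λ i → p (Fin.suc i))

sumℕ : ∀ {m} → (Fin m → ℕ) → ℕ
sumℕ {zero}  f = 0
sumℕ {suc m} f = f Fin.zero ℕ.+ sumℕ (λ i → f (Fin.suc i))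

anyF : ∀ {m} → (Fin m → Bool) → Bool
anyF {zero}  p = false
anyF {suc m} p = p Fin.zero ∨ anyF (λ i → p (Fin.suc i))

allF : ∀ {m} → (Fin m → Bool) → Bool
allF {zero}  p = true
allF {suc m} p = p Fin.zero ∧ allF (λ i → p (Fin.suc i))

_==_ : ∀ {m} → Fin m → Fin m → Bool
i == j = ⌊ i Fin.≟ j ⌋

_==ℕ_ : ℕ → ℕ → Bool
a ==ℕ b = ⌊ a ℕ.≟ b ⌋

cons : ∀ {A : Set} {m} → A → (Fin m → A) → Fin (suc m) → A
cons x f Fin.zero    = x
cons x f (Fin.suc i) = f i

allFuns : ∀ {A : Set} → List A → (m : ℕ) → List (Fin m → A)
allFuns xs zero    = (λ ()) ∷ []
allFuns xs (suc m) = concatMap (λ f → List.map (λ x → cons x f) xs) (allFuns xs m)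

allSubsets : (r : ℕ) → List (Vec Bool r)
allSubsets zero    = Vec.[] ∷ []
allSubsets (suc r) = concatMap (λ v → (false Vec.∷ v) ∷ (true Vec.∷ v) ∷ []) (allSubsets r)

card : ∀ {r} → Vec Bool r → ℕ
card v = count (lookup v)

-- successor modulo n on boundary labels (label i ↦ i+1, n ↦ 1)
next : ∀ {n} → Fin n → Fin n
next {suc n} i with suc (toℕ i) <? suc n
... | yes p = fromℕ< p
... | no  _ = Fin.zero

isEven : ℕ → Bool
isEven zero = true
isEven (suc j) = not (isEven j)

iter : ∀ {A : Set} → (A → A) → ℕ → A → A
iter f zero    a = a
iter f (suc j) a = f (iter f j a)

-- "R has exactly k classes": a surjection onto Fin k whose kernel is R
record Classes {A : Set} (R : A → A → Set) (k : ℕ) : Set where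
  field
    cls  : A → Fin k
    surj : ∀ j → ∃[ a ] (cls a ≡ j)
    ker  : ∀ a b → (cls a ≡ cls b) ⇔ R a b

HasSize : Set → ℕ → Set
HasSize A k = Classes {A} _≡_ k

-- Vertices: boundary (black) ⊎ interior white ⊎ interior black
Vertex : ℕ → ℕ → ℕ → Set
Vertex n nW nB = Fin n ⊎ (Fin nW ⊎ Fin nB)

-- Darts of the augmented graph  G ∪ (boundary circle 1→2→…→n→1):
-- (inj₁ e , true) = dart of edge e at its white end, (inj₁ e , false) at its black end;
-- (inj₂ i , true) = boundary arc i→i+1 at i,  (inj₂ i , false) = same arc at i+1.
Dart : ℕ → ℕ → Set
Dart m n = (Fin m ⊎ Fin n) × Bool

flip : ∀ {m n} → Dart m n → Dart m n
flip (x , b) = (x , not b)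

tailD : ∀ {m n nW nB} → (Fin m → Fin nW) → (Fin m → Fin n ⊎ Fin nB) →
        Dart m n → Vertex n nW nB
tailD white black (inj₁ e , true)  = inj₂ (inj₁ (white e))
tailD white black (inj₁ e , false) with black e
... | inj₁ i = inj₁ i
... | inj₂ b = inj₂ (inj₂ b)
tailD white black (inj₂ i , true)  = inj₁ i
tailD white black (inj₂ i , false) = inj₁ (next i)

-- connectivity of vertices along darts (d goes from tail d to tail (flip d))
data Conn {m n : ℕ} {V : Set} (t : Dart m n → V) : V → V → Set where
  conn-refl : ∀ {v} → Conn t v v
  conn-step : ∀ {u} d → Conn t u (t d) → Conn t u (t (flip d))

module _ (K : ACF0) where
  open ACF0 K

  record Network (n : ℕ) : Set where
    field
      nW nB m : ℕ
      white   : Fin m → Fin nW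
      black   : Fin m → Fin n ⊎ Fin nB
      wt      : Fin m → Carrier
      wt≉0    : ∀ e → ¬ (wt e ≈ 0#)
      bdry≤1  : ∀ i e e' → black e ≡ inj₁ i → black e' ≡ inj₁ i → e ≡ e'

    tail : Dart m n → Vertex n nW nB
    tail = tailD white black

    field
      -- planar embedding in the disk, as a rotation system of the augmented graph
      σ        : Dart m n → Dart m n
      σ⁻       : Dart m n → Dart m n
      σσ⁻      : ∀ d → σ (σ⁻ d) ≡ d
      σ⁻σ      : ∀ d → σ⁻ (σ d) ≡ d
      σ-tail   : ∀ d → tail (σ d) ≡ tail d
      σ-trans  : ∀ d d' → tail d ≡ tail d' → ∃[ j ] (iter σ j d ≡ d')
      -- the boundary circle bounds a face (the outside of the disk), traversed 1→2→…→n→1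
      outer    : ∀ i → σ (inj₂ i , false) ≡ (inj₂ (next i) , true)

    field
      -- Euler: V − E + F + (#isolated vertices) = 2·(#components), i.e. genus 0
      #faces #comps #isol : ℕ
      faces    : Classes (λ d d' → ∃[ j ] (iter (λ x → σ (flip x)) j d ≡ d')) #faces
      comps    : Classes (Conn tail) #comps
      isol     : HasSize (Σ (Vertex n nW nB) (λ v → ∀ d → ¬ (tail d ≡ v))) #isol
      euler    : n ℕ.+ nW ℕ.+ nB ℕ.+ #faces ℕ.+ #isol ≡ (m ℕ.+ n) ℕ.+ (#comps ℕ.+ #comps)

  open Network public

  Σl : List Carrier → Carrier
  Σl = foldr _+_ 0#

  prodF : ∀ {m} → (Fin m → Carrier) → Carrier
  prodF {zero}  f = 1#
  prodF {suc m} f = f Fin.zero * prodF (λ i → f (Fin.suc i))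

  _^_ : Carrier → ℕ → Carrier
  x ^ zero  = 1#
  x ^ suc j = x * (x ^ j)

  module _ {n : ℕ} (N : Network n) where

    atW : Fin (nW N) → Fin (m N) → Bool
    atW w e = white N e == w

    atB : Fin (nB N) → Fin (m N) → Bool
    atB b e with black N e
    ... | inj₁ _  = false
    ... | inj₂ b' = b' == b

    atBd : Fin n → Fin (m N) → Bool
    atBd i e with black N e
    ... | inj₁ i' = i' == i
    ... | inj₂ _  = false

    -- dimer configurations (almost perfect matchings), as edge subsets
    isAPM : (Fin (m N) → Bool) → Bool
    isAPM π = allF (λ w → count (λ e → π e ∧ atW w e) ==ℕ 1)
            ∧ allF (λ b → count (λ e → π e ∧ atB b e) ==ℕ 1)
            ∧ allF (λ i → ⌊ count (λ e → π e ∧ atBd i e) ℕ.≤? 1 ⌋)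

    ∂ : (Fin (m N) → Bool) → Fin n → Bool
    ∂ π i = anyF (λ e → π e ∧ atBd i e)

    wtM : (Fin (m N) → Bool) → Carrier
    wtM π = prodF (λ e → if π e then wt N e else 1#)

    sameSet : (Fin n → Bool) → (Fin n → Bool) → Bool
    sameSet I J = allF (λ i → ⌊ I i Data.Bool.≟ J i ⌋)

    Δ : (Fin n → Bool) → Carrier
    Δ I = Σl (List.map (λ π → if isAPM π ∧ sameSet (∂ π) I then wtM π else 0#)
                       (allFuns (false ∷ true ∷ []) (m N)))

    HasAPM : Set
    HasAPM = Σ (Fin (m N) → Bool) (λ π → isAPM π ≡ true)

    -- r-weblike subgraphs: multiplicities μ e ∈ {0,…,r}, 0 meaning e ∉ W
    module _ (r : ℕ) where

      mult : (Fin (m N) → Fin (suc r)) → Fin (m N) → ℕ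
      mult μ e = toℕ (μ e)

      isWeb : (Fin (m N) → Fin (suc r)) → Bool
      isWeb μ = allF (λ w → sumℕ (λ e → if atW w e then mult μ e else 0) ==ℕ r)
              ∧ allF (λ b → sumℕ (λ e → if atB b e then mult μ e else 0) ==ℕ r)

      -- degree λ(W)_j = m(b_j)  (0 if b_j does not exist)
      degW : (Fin (m N) → Fin (suc r)) → Fin n → ℕ
      degW μ j = sumℕ (λ e → if atBd j e then mult μ e else 0)

      wtW : (Fin (m N) → Fin (suc r)) → Carrier
      wtW μ = prodF (λ e → wt N e ^ mult μ e)

      -- consistent labelings L with boundary sets S (L e = ∅ for e ∉ W)
      isLabeling : (Fin (m N) → Fin (suc r)) → (Fin n → Vec Bool r) →
                   (Fin (m N) → Vec Bool r) → Bool
      isLabeling μ S L =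
          allF (λ e → card (L e) ==ℕ mult μ e)
        ∧ allF (λ w → allF (λ x → count (λ e → atW w e ∧ lookup (L e) x) ==ℕ 1))
        ∧ allF (λ b → allF (λ x → count (λ e → atB b e ∧ lookup (L e) x) ==ℕ 1))
        ∧ allF (λ j → allF (λ x →
              ⌊ anyF (λ e → atBd j e ∧ lookup (L e) x) Data.Bool.≟ lookup (S j) x ⌋))

      aCount : (Fin (m N) → Fin (suc r)) → (Fin n → Vec Bool r) → ℕ
      aCount μ S = List.length (filter (λ L → isLabeling μ S L Data.Bool.≟ true)
                                       (allFuns (allSubsets r) (m N)))

  IsType : {n r : ℕ} (k : ℕ) (λ' : Fin n → ℕ) → (Fin n → Vec Bool r) → Set
  IsType {n} {r} k λ' S = (∀ j → card (S j) ≡ λ' j)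
                        × (∀ x → count (λ j → lookup (S j) x) ≡ k)

  elems : ∀ {r} → Vec Bool r → List (Fin r)
  elems v = filter (λ x → lookup v x Data.Bool.≟ true) (allFin _)

  inversions : ∀ {r} → List (Fin r) → ℕ
  inversions []       = 0
  inversions (x ∷ xs) = List.length (filter (λ y → y Fin.<? x) xs) ℕ.+ inversions xs

  sign : ∀ {n r} → (Fin n → Vec Bool r) → Carrier
  sign {n} S = if isEven (inversions (concatMap (λ j → elems (S j)) (allFin n)))
               then 1# else - 1#

  -- Web_r(N;λ) evaluated on the basis tensor E_S (S a list of type λ):
  --   Σ_{W : λ(W) = λ} wt(W) · sign(S) · a(S;W)
  WebAt : ∀ {n} → Network n → (r : ℕ) → (Fin n → ℕ) → (Fin n → Vec Bool r) → Carrier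
  WebAt N r λ' S =
    Σl (List.map (λ μ → if isWeb N r μ ∧ allF (λ j → degW N r μ j ==ℕ λ' j)
                        then wtW N r μ * (sign S * fromℕ cring (aCount N r μ S))
                        else 0#)
                 (allFuns (allFin (suc r)) (m N)))

-- A consistent labeling of an r-weblike subgraph W is the same thing as an r-tuple of dimer
-- configurations: for each x ∈ [r] the edges whose label contains x form an almost perfect
-- matching π_x with ∂π_x = I_x = {j | x ∈ S_j}. Conversely the tuple recovers W through
-- m(e) = #{x | e ∈ π_x}; W is then automatically r-weblike of degree (|S_1|, …, |S_n|), and
-- wt(W) = ∏_x wt(π_x). Summing over W and its labelings therefore gives
--   Web_r(N;λ)(E_S) = sign(S) · ∏_{x ∈ [r]} Δ_{I_x}(N),
-- and every I_x has k elements because S has type λ, so Web_r(N;λ) is determined by X̃(N).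

module Submission where

open import Defs
open import Data.Nat as ℕ using (ℕ; _≤_; z≤n; s≤s)
open import Data.Fin using (Fin)
open import Data.Vec using (Vec)
open import Data.Bool using (Bool)
open import Relation.Binary.PropositionalEquality using (_≡_)

open import Algebra.Bundles using (CommutativeSemiring)
import Algebra.Properties.CommutativeMonoid.Sum as MonoidSum
import Algebra.Properties.CommutativeSemigroup as CommSemigroupProps
open import Data.Bool using (true; false; T; if_then_else_; _∧_; _∨_)
open import Data.Bool.Properties using (T-∧; T-≡; ∧-comm; ∧-assoc; ∧-identityʳ; ∧-commutativeMonoid)
open import Data.Empty using (⊥-elim)
open import Data.Fin using (zero; suc; toℕ; fromℕ<; punchIn)
open import Data.Fin.Properties using (0≢1+n; suc-injective; toℕ-fromℕ<; toℕ-injective; punchInᵢ≢i)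
open import Data.List using (List; []; _∷_; _++_; concatMap; allFin; foldr; map; tabulate; filter; length)
open import Data.List.Properties using (map-∘)
open import Data.Nat.Properties using (m≤n⇒m≤1+n; +-0-commutativeMonoid)
open import Data.Product using (_,_; proj₁; proj₂)
open import Data.Sum using (inj₁)
open import Data.Unit using (tt)
open import Data.Vec as Vec using (lookup)
open import Function using (id; _∘_; _⇔_; mk⇔; Equivalence)
open import Relation.Binary.Core using (_Preserves_⟶_)
open import Relation.Binary.PropositionalEquality as ≡ using (cong; cong₂; subst; _≗_; _≢_; module ≡-Reasoning)
import Relation.Binary.Reasoning.Setoid as SetoidReasoning
open import Relation.Nullary using (¬_)
open import Relation.Nullary.Decidable using (⌊_⌋; toWitness; fromWitness)

open Equivalence using (to; from)

allF-cong : ∀ {q} {p p′ : Fin q → Bool} → p ≗ p′ → allF p ≡ allF p′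
allF-cong {ℕ.zero}  eq = ≡.refl
allF-cong {ℕ.suc q} eq = cong₂ _∧_ (eq zero) (allF-cong (eq ∘ suc))

anyF-cong : ∀ {q} {p p′ : Fin q → Bool} → p ≗ p′ → anyF p ≡ anyF p′
anyF-cong {ℕ.zero}  eq = ≡.refl
anyF-cong {ℕ.suc q} eq = cong₂ _∨_ (eq zero) (anyF-cong (eq ∘ suc))

count-cong : ∀ {q} {p p′ : Fin q → Bool} → p ≗ p′ → count p ≡ count p′
count-cong {ℕ.zero}  eq = ≡.refl
count-cong {ℕ.suc q} eq = cong₂ (λ b c → (if b then 1 else 0) ℕ.+ c) (eq zero) (count-cong (eq ∘ suc))

sumℕ-cong : ∀ {q} {f g : Fin q → ℕ} → f ≗ g → sumℕ f ≡ sumℕ g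
sumℕ-cong {ℕ.zero}  eq = ≡.refl
sumℕ-cong {ℕ.suc q} eq = cong₂ ℕ._+_ (eq zero) (sumℕ-cong (eq ∘ suc))

T-allF : ∀ {q} {p : Fin q → Bool} → T (allF p) ⇔ (∀ i → T (p i))
T-allF {ℕ.zero}      = mk⇔ (λ _ ()) (λ _ → tt)
T-allF {ℕ.suc q} {p} = mk⇔
  (λ h → λ { zero → proj₁ (to T-∧ h) ; (suc i) → to T-allF (proj₂ (to T-∧ h)) i })
  (λ h → from T-∧ (h zero , from T-allF (h ∘ suc)))

module ⋀ = MonoidSum ∧-commutativeMonoid
module ∑ℕ = MonoidSum +-0-commutativeMonoid

allF≡⋀ : ∀ {q} (p : Fin q → Bool) → allF p ≡ ⋀.sum p
allF≡⋀ {ℕ.zero}  p = ≡.refl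
allF≡⋀ {ℕ.suc q} p = cong (p zero ∧_) (allF≡⋀ (p ∘ suc))

allF-∧ : ∀ {q} (p p′ : Fin q → Bool) → allF (λ i → p i ∧ p′ i) ≡ allF p ∧ allF p′
allF-∧ p p′ = begin
  allF (λ i → p i ∧ p′ i)  ≡⟨ allF≡⋀ (λ i → p i ∧ p′ i) ⟩
  ⋀.sum (λ i → p i ∧ p′ i) ≡⟨ ⋀.∑-distrib-+ p p′ ⟩
  ⋀.sum p ∧ ⋀.sum p′       ≡⟨ cong₂ _∧_ (allF≡⋀ p) (allF≡⋀ p′) ⟨
  allF p ∧ allF p′         ∎
  where open ≡-Reasoning

allF-comm : ∀ {q s} (p : Fin q → Fin s → Bool) →
            allF (λ i → allF (p i)) ≡ allF (λ j → allF (λ i → p i j))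
allF-comm p = begin
  allF (λ i → allF (p i))               ≡⟨ allF≡⋀ (λ i → allF (p i)) ⟩
  ⋀.sum (λ i → allF (p i))              ≡⟨ ⋀.sum-cong-≗ (allF≡⋀ ∘ p) ⟩
  ⋀.sum (λ i → ⋀.sum (p i))             ≡⟨ ⋀.∑-comm p ⟩
  ⋀.sum (λ j → ⋀.sum (λ i → p i j))     ≡⟨ ⋀.sum-cong-≗ (λ j → allF≡⋀ (λ i → p i j)) ⟨
  ⋀.sum (λ j → allF (λ i → p i j))      ≡⟨ allF≡⋀ (λ j → allF (λ i → p i j)) ⟨
  allF (λ j → allF (λ i → p i j))       ∎
  where open ≡-Reasoning

count≤ : ∀ {q} (p : Fin q → Bool) → count p ≤ q
count≤ {ℕ.zero}  p = z≤n
count≤ {ℕ.suc q} p with p zero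
... | true  = s≤s (count≤ (p ∘ suc))
... | false = m≤n⇒m≤1+n (count≤ (p ∘ suc))

count-none : ∀ {q} (p : Fin q → Bool) → (∀ i → ¬ T (p i)) → count p ≡ 0
count-none {ℕ.zero}  p none = ≡.refl
count-none {ℕ.suc q} p none with p zero in eq
... | true  = ⊥-elim (none zero (from T-≡ eq))
... | false = count-none (p ∘ suc) (none ∘ suc)

count-atMostOne : ∀ {q} (p : Fin q → Bool) → (∀ i j → T (p i) → T (p j) → i ≡ j) →
                  count p ≡ (if anyF p then 1 else 0)
count-atMostOne {ℕ.zero}  p unique = ≡.refl
count-atMostOne {ℕ.suc q} p unique with p zero in eq
... | true  = cong ℕ.suc (count-none (p ∘ suc) λ i pi → 0≢1+n (unique zero (suc i) (from T-≡ eq) pi))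
... | false = count-atMostOne (p ∘ suc) λ i j pi pj → suc-injective (unique (suc i) (suc j) pi pj)

count-∧ˡ : ∀ {q} (b : Bool) (p : Fin q → Bool) → count (λ i → b ∧ p i) ≡ (if b then count p else 0)
count-∧ˡ true  p = ≡.refl
count-∧ˡ false p = count-none (λ i → false ∧ p i) (λ _ ())

sumℕ-ones : ∀ q → sumℕ {q} (λ _ → 1) ≡ q
sumℕ-ones ℕ.zero    = ≡.refl
sumℕ-ones (ℕ.suc q) = cong ℕ.suc (sumℕ-ones q)

sumℕ≡∑ : ∀ {q} (f : Fin q → ℕ) → sumℕ f ≡ ∑ℕ.sum f
sumℕ≡∑ {ℕ.zero}  f = ≡.refl
sumℕ≡∑ {ℕ.suc q} f = cong (f zero ℕ.+_) (sumℕ≡∑ (f ∘ suc))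

count≡sumℕ : ∀ {q} (p : Fin q → Bool) → count p ≡ sumℕ (λ i → if p i then 1 else 0)
count≡sumℕ {ℕ.zero}  p = ≡.refl
count≡sumℕ {ℕ.suc q} p = cong ((if p zero then 1 else 0) ℕ.+_) (count≡sumℕ (p ∘ suc))

sumℕ-comm : ∀ {q s} (f : Fin q → Fin s → ℕ) →
            sumℕ (λ i → sumℕ (f i)) ≡ sumℕ (λ j → sumℕ (λ i → f i j))
sumℕ-comm f = begin
  sumℕ (λ i → sumℕ (f i))               ≡⟨ sumℕ≡∑ (λ i → sumℕ (f i)) ⟩
  ∑ℕ.sum (λ i → sumℕ (f i))             ≡⟨ ∑ℕ.sum-cong-≗ (sumℕ≡∑ ∘ f) ⟩
  ∑ℕ.sum (λ i → ∑ℕ.sum (f i))           ≡⟨ ∑ℕ.∑-comm f ⟩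
  ∑ℕ.sum (λ j → ∑ℕ.sum (λ i → f i j))   ≡⟨ ∑ℕ.sum-cong-≗ (λ j → sumℕ≡∑ (λ i → f i j)) ⟨
  ∑ℕ.sum (λ j → sumℕ (λ i → f i j))     ≡⟨ sumℕ≡∑ (λ j → sumℕ (λ i → f i j)) ⟨
  sumℕ (λ j → sumℕ (λ i → f i j))       ∎
  where open ≡-Reasoning

sum-count-comm : ∀ {q s} (p : Fin q → Fin s → Bool) →
                 sumℕ (λ i → count (p i)) ≡ sumℕ (λ j → count (λ i → p i j))
sum-count-comm p = begin
  sumℕ (λ i → count (p i))                                   ≡⟨ sumℕ-cong (count≡sumℕ ∘ p) ⟩
  sumℕ (λ i → sumℕ (λ j → if p i j then 1 else 0))           ≡⟨ sumℕ-comm (λ i j → if p i j then 1 else 0) ⟩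
  sumℕ (λ j → sumℕ (λ i → if p i j then 1 else 0))           ≡⟨ sumℕ-cong (λ j → count≡sumℕ (λ i → p i j)) ⟨
  sumℕ (λ j → count (λ i → p i j))                           ∎
  where open ≡-Reasoning

bools : List Bool
bools = false ∷ true ∷ []

-- For S this is I_x = {j | x ∈ S_j}; for a labeling L it is the x-th dimer configuration.
column : ∀ {A : Set} {r} → (A → Vec Bool r) → Fin r → A → Bool
column L x a = lookup (L a) x

module Sums {c ℓ} (R : CommutativeSemiring c ℓ) where
  open CommutativeSemiring R hiding (zero)
  open SetoidReasoning setoid
  open CommSemigroupProps +-commutativeSemigroup using (interchange)
  module ∑ = MonoidSum +-commutativeMonoid
  module ∏ = MonoidSum *-commutativeMonoid

  private variable
    A B Z : Set

  ∏ : ∀ {q} → (Fin q → Carrier) → Carrier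
  ∏ = ∏.sum

  ∑ₗ : List A → (A → Carrier) → Carrier
  ∑ₗ xs f = foldr _+_ 0# (map f xs)

  ∑ₗ-cong : (xs : List A) {f g : A → Carrier} → (∀ a → f a ≈ g a) → ∑ₗ xs f ≈ ∑ₗ xs g
  ∑ₗ-cong []       eq = refl
  ∑ₗ-cong (x ∷ xs) eq = +-cong (eq x) (∑ₗ-cong xs eq)

  ∑ₗ-zero : (xs : List A) {f : A → Carrier} → (∀ a → f a ≈ 0#) → ∑ₗ xs f ≈ 0#
  ∑ₗ-zero []       z = refl
  ∑ₗ-zero (x ∷ xs) z = trans (+-cong (z x) (∑ₗ-zero xs z)) (+-identityʳ 0#)

  ∑ₗ-++ : (xs ys : List A) (f : A → Carrier) → ∑ₗ (xs ++ ys) f ≈ ∑ₗ xs f + ∑ₗ ys f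
  ∑ₗ-++ []       ys f = sym (+-identityˡ _)
  ∑ₗ-++ (x ∷ xs) ys f = trans (+-congˡ (∑ₗ-++ xs ys f)) (sym (+-assoc _ _ _))

  ∑ₗ-distrib-+ : (xs : List A) (f g : A → Carrier) → ∑ₗ xs (λ a → f a + g a) ≈ ∑ₗ xs f + ∑ₗ xs g
  ∑ₗ-distrib-+ []       f g = sym (+-identityˡ 0#)
  ∑ₗ-distrib-+ (x ∷ xs) f g = trans (+-congˡ (∑ₗ-distrib-+ xs f g)) (interchange _ _ _ _)

  *-distribˡ-∑ₗ : ∀ c (xs : List A) (f : A → Carrier) → c * ∑ₗ xs f ≈ ∑ₗ xs (λ a → c * f a)
  *-distribˡ-∑ₗ c []       f = zeroʳ c
  *-distribˡ-∑ₗ c (x ∷ xs) f = trans (distribˡ c _ _) (+-congˡ (*-distribˡ-∑ₗ c xs f))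

  *-distribʳ-∑ₗ : ∀ c (xs : List A) (f : A → Carrier) → ∑ₗ xs f * c ≈ ∑ₗ xs (λ a → f a * c)
  *-distribʳ-∑ₗ c []       f = zeroˡ c
  *-distribʳ-∑ₗ c (x ∷ xs) f = trans (distribʳ c _ _) (+-congˡ (*-distribʳ-∑ₗ c xs f))

  ∑ₗ-comm : (xs : List A) (ys : List B) (f : A → B → Carrier) →
            ∑ₗ xs (λ a → ∑ₗ ys (f a)) ≈ ∑ₗ ys (λ b → ∑ₗ xs (λ a → f a b))
  ∑ₗ-comm []       ys f = sym (∑ₗ-zero ys (λ _ → refl))
  ∑ₗ-comm (x ∷ xs) ys f = trans (+-congˡ (∑ₗ-comm xs ys f)) (sym (∑ₗ-distrib-+ ys (f x) _))

  ∑ₗ-map : (g : B → A) (xs : List B) (f : A → Carrier) → ∑ₗ (map g xs) f ≡ ∑ₗ xs (f ∘ g)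
  ∑ₗ-map g xs f = cong (foldr _+_ 0#) (≡.sym (map-∘ xs))

  *-if-1-0 : ∀ x (b : Bool) → x * (if b then 1# else 0#) ≈ (if b then x else 0#)
  *-if-1-0 x true  = *-identityʳ x
  *-if-1-0 x false = zeroʳ x

  if-0-*ˡ : ∀ x y (b : Bool) → (if b then x * y else 0#) ≈ x * (if b then y else 0#)
  if-0-*ˡ x y true  = refl
  if-0-*ˡ x y false = sym (zeroʳ x)

  if-0-cong : ∀ (b : Bool) {x y} → x ≈ y → (if b then x else 0#) ≈ (if b then y else 0#)
  if-0-cong true  x≈y = x≈y
  if-0-cong false x≈y = refl

  ∑ₗ-concatMap : (h : A → List B) (xs : List A) (f : B → Carrier) →
                 ∑ₗ (concatMap h xs) f ≈ ∑ₗ xs (λ a → ∑ₗ (h a) f)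
  ∑ₗ-concatMap h []       f = refl
  ∑ₗ-concatMap h (x ∷ xs) f = trans (∑ₗ-++ (h x) _ f) (+-congˡ (∑ₗ-concatMap h xs f))

  ∑ₗ-tabulate : ∀ {k} (g : Fin k → A) (f : A → Carrier) → ∑ₗ (tabulate g) f ≡ ∑.sum (f ∘ g)
  ∑ₗ-tabulate {k = ℕ.zero}  g f = ≡.refl
  ∑ₗ-tabulate {k = ℕ.suc k} g f = cong (f (g zero) +_) (∑ₗ-tabulate (g ∘ suc) f)

  ∑-δ : ∀ {k} (f : Fin k → Carrier) (i : Fin k) → (∀ j → j ≢ i → f j ≈ 0#) → ∑.sum f ≈ f i
  ∑-δ {ℕ.suc k} f i vanish = begin
    ∑.sum f                          ≈⟨ ∑.sum-remove f ⟩
    f i + ∑.sum (f ∘ punchIn i)      ≈⟨ +-congˡ (∑.sum-cong-≋ (λ j → vanish _ (punchInᵢ≢i i j))) ⟩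
    f i + ∑.sum {k} (λ _ → 0#)       ≈⟨ +-congˡ (∑.sum-replicate-zero k) ⟩
    f i + 0#                         ≈⟨ +-identityʳ (f i) ⟩
    f i                              ∎

  ∑ₗ-allFuns-suc : ∀ (xs : List A) q (F : (Fin (ℕ.suc q) → A) → Carrier) →
                   ∑ₗ (allFuns xs (ℕ.suc q)) F ≈ ∑ₗ (allFuns xs q) (λ f → ∑ₗ xs (λ x → F (cons x f)))
  ∑ₗ-allFuns-suc xs q F = trans (∑ₗ-concatMap _ (allFuns xs q) F)
                                (∑ₗ-cong (allFuns xs q) (λ f → reflexive (∑ₗ-map (λ x → cons x f) xs F)))

  ∑ₗ-allFuns-singleton : ∀ (a : A) q c → ∑ₗ (allFuns (a ∷ []) q) (λ _ → c) ≈ c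
  ∑ₗ-allFuns-singleton a ℕ.zero    c = +-identityʳ c
  ∑ₗ-allFuns-singleton a (ℕ.suc q) c = begin
    ∑ₗ (allFuns (a ∷ []) (ℕ.suc q)) (λ _ → c)    ≈⟨ ∑ₗ-allFuns-suc (a ∷ []) q (λ _ → c) ⟩
    ∑ₗ (allFuns (a ∷ []) q) (λ _ → c + 0#)       ≈⟨ ∑ₗ-cong (allFuns (a ∷ []) q) (λ _ → +-identityʳ c) ⟩
    ∑ₗ (allFuns (a ∷ []) q) (λ _ → c)            ≈⟨ ∑ₗ-allFuns-singleton a q c ⟩
    c                                            ∎

  ∑ₗ-allFuns-δ : ∀ {k} q (F : (Fin q → Fin k) → Carrier) (f₀ : Fin q → Fin k) {v} →
                 (∀ f → f ≗ f₀ → F f ≈ v) → (∀ f → ¬ f ≗ f₀ → F f ≈ 0#) →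
                 ∑ₗ (allFuns (allFin k) q) F ≈ v
  ∑ₗ-allFuns-δ ℕ.zero F f₀ at off = trans (+-identityʳ _) (at _ (λ ()))
  ∑ₗ-allFuns-δ {k} (ℕ.suc q) F f₀ {v} at off = begin
    ∑ₗ (allFuns (allFin k) (ℕ.suc q)) F
      ≈⟨ ∑ₗ-allFuns-suc (allFin k) q F ⟩
    ∑ₗ (allFuns (allFin k) q) (λ f → ∑ₗ (allFin k) (λ x → F (cons x f)))
      ≈⟨ ∑ₗ-cong (allFuns (allFin k) q) (λ f → reflexive (∑ₗ-tabulate id (λ x → F (cons x f)))) ⟩
    ∑ₗ (allFuns (allFin k) q) (λ f → ∑.sum (λ x → F (cons x f)))
      ≈⟨ ∑ₗ-cong (allFuns (allFin k) q) (λ f → ∑-δ _ (f₀ zero) (λ x x≢ → off _ (λ eq → x≢ (eq zero)))) ⟩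
    ∑ₗ (allFuns (allFin k) q) (λ f → F (cons (f₀ zero) f))
      ≈⟨ ∑ₗ-allFuns-δ q _ (f₀ ∘ suc) (λ f eq → at _ (cons-≗ eq)) (λ f ≇ → off _ (≇ ∘ (_∘ suc))) ⟩
    v ∎
    where
    cons-≗ : ∀ {f} → f ≗ f₀ ∘ suc → cons (f₀ zero) f ≗ f₀
    cons-≗ eq zero    = ≡.refl
    cons-≗ eq (suc e) = eq e

  ∑ₗ-allFuns-pairs : ∀ (c : A → B → Z) (as : List A) (bs : List B) q
                       (F : (Fin q → Z) → Carrier) → F Preserves _≗_ ⟶ _≈_ →
                     ∑ₗ (allFuns (concatMap (λ b → map (λ a → c a b) as) bs) q) F
                       ≈ ∑ₗ (allFuns bs q) (λ g → ∑ₗ (allFuns as q) (λ f → F (λ e → c (f e) (g e))))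
  ∑ₗ-allFuns-pairs c as bs ℕ.zero F F-cong = trans (+-congʳ (F-cong (λ ()))) (sym (+-identityʳ _))
  ∑ₗ-allFuns-pairs {Z = Z} c as bs (ℕ.suc q) F F-cong = begin
    ∑ₗ (allFuns zs (ℕ.suc q)) F
      ≈⟨ ∑ₗ-allFuns-suc zs q F ⟩
    ∑ₗ (allFuns zs q) G
      ≈⟨ ∑ₗ-allFuns-pairs c as bs q G G-cong ⟩
    ∑ₗ (allFuns bs q) (λ g → ∑ₗ (allFuns as q) (λ f → ∑ₗ zs (λ z → F (cons z (pairUp f g)))))
      ≈⟨ ∑ₗ-cong (allFuns bs q) (λ g → ∑ₗ-cong (allFuns as q) (λ f → split-zs (λ z → F (cons z (pairUp f g))))) ⟩
    ∑ₗ (allFuns bs q) (λ g → ∑ₗ (allFuns as q) (λ f → ∑ₗ bs (λ b → ∑ₗ as (λ a → F (cons (c a b) (pairUp f g))))))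
      ≈⟨ ∑ₗ-cong (allFuns bs q) (λ g → ∑ₗ-comm (allFuns as q) bs _) ⟩
    ∑ₗ (allFuns bs q) (λ g → ∑ₗ bs (λ b → ∑ₗ (allFuns as q) (λ f → ∑ₗ as (λ a → F (cons (c a b) (pairUp f g))))))
      ≈⟨ ∑ₗ-cong (allFuns bs q) (λ g → ∑ₗ-cong bs (λ b → ∑ₗ-cong (allFuns as q) (λ f → ∑ₗ-cong as (λ a →
           F-cong (cons-pairUp a b f g)))))  ⟩
    ∑ₗ (allFuns bs q) (λ g → ∑ₗ bs (λ b →
      ∑ₗ (allFuns as q) (λ f → ∑ₗ as (λ a → F (pairUp (cons a f) (cons b g))))))
      ≈⟨ ∑ₗ-cong (allFuns bs q) (λ g → ∑ₗ-cong bs (λ b → sym (∑ₗ-allFuns-suc as q _))) ⟩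
    ∑ₗ (allFuns bs q) (λ g → ∑ₗ bs (λ b → ∑ₗ (allFuns as (ℕ.suc q)) (λ f → F (pairUp f (cons b g)))))
      ≈⟨ ∑ₗ-allFuns-suc bs q _ ⟨
    ∑ₗ (allFuns bs (ℕ.suc q)) (λ g → ∑ₗ (allFuns as (ℕ.suc q)) (λ f → F (pairUp f g))) ∎
    where
    zs : List Z
    zs = concatMap (λ b → map (λ a → c a b) as) bs
    pairUp : ∀ {p} → (Fin p → _) → (Fin p → _) → Fin p → Z
    pairUp f g e = c (f e) (g e)
    G : (Fin q → Z) → Carrier
    G h = ∑ₗ zs (λ z → F (cons z h))
    G-cong : G Preserves _≗_ ⟶ _≈_
    G-cong eq = ∑ₗ-cong zs (λ z → F-cong λ { zero → ≡.refl ; (suc e) → eq e })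
    split-zs : (φ : Z → Carrier) → ∑ₗ zs φ ≈ ∑ₗ bs (λ b → ∑ₗ as (λ a → φ (c a b)))
    split-zs φ = trans (∑ₗ-concatMap _ bs φ) (∑ₗ-cong bs (λ b → reflexive (∑ₗ-map _ as φ)))
    cons-pairUp : ∀ a b f g → cons (c a b) (pairUp f g) ≗ pairUp (cons a f) (cons b g)
    cons-pairUp a b f g zero    = ≡.refl
    cons-pairUp a b f g (suc e) = ≡.refl

  ∑ₗ-allFuns-columns : ∀ r q (g : Fin r → (Fin q → Bool) → Carrier) → (∀ x → g x Preserves _≗_ ⟶ _≈_) →
                       ∑ₗ (allFuns (allSubsets r) q) (λ L → ∏ (λ x → g x (column L x)))
                         ≈ ∏ (λ x → ∑ₗ (allFuns bools q) (g x))
  ∑ₗ-allFuns-columns ℕ.zero    q g g-cong = ∑ₗ-allFuns-singleton Vec.[] q 1#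
  ∑ₗ-allFuns-columns (ℕ.suc r) q g g-cong = begin
    ∑ₗ (allFuns (allSubsets (ℕ.suc r)) q) (λ L → ∏ (λ x → g x (column L x)))
      ≈⟨ ∑ₗ-allFuns-pairs Vec._∷_ bools (allSubsets r) q _ ∏-cong ⟩
    ∑ₗ (allFuns (allSubsets r) q) (λ L → ∑ₗ (allFuns bools q) (λ π → g zero π * rest L))
      ≈⟨ ∑ₗ-cong (allFuns (allSubsets r) q) (λ L → *-distribʳ-∑ₗ (rest L) (allFuns bools q) (g zero)) ⟨
    ∑ₗ (allFuns (allSubsets r) q) (λ L → first * rest L)
      ≈⟨ *-distribˡ-∑ₗ first (allFuns (allSubsets r) q) rest ⟨
    first * ∑ₗ (allFuns (allSubsets r) q) rest
      ≈⟨ *-congˡ (∑ₗ-allFuns-columns r q (g ∘ suc) (g-cong ∘ suc)) ⟩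
    first * ∏ (λ x → ∑ₗ (allFuns bools q) (g (suc x))) ∎
    where
    first : Carrier
    first = ∑ₗ (allFuns bools q) (g zero)
    rest : (Fin q → Vec Bool r) → Carrier
    rest L = ∏ (λ x → g (suc x) (column L x))
    ∏-cong : (λ L → ∏ (λ x → g x (column L x))) Preserves _≗_ ⟶ _≈_
    ∏-cong eq = ∏.sum-cong-≋ (λ x → g-cong x (λ e → cong (λ v → lookup v x) (eq e)))

module _ (K : ACF0) where
  open ACF0 K hiding (zero)
  open Sums commutativeSemiring
  module ≈-Reasoning = SetoidReasoning setoid

  prodF≡∏ : ∀ {q} (f : Fin q → Carrier) → prodF K f ≡ ∏ f
  prodF≡∏ {ℕ.zero}  f = ≡.refl
  prodF≡∏ {ℕ.suc q} f = cong (f zero *_) (prodF≡∏ (f ∘ suc))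

  prodF-cong : ∀ {q} {f g : Fin q → Carrier} → (∀ i → f i ≈ g i) → prodF K f ≈ prodF K g
  prodF-cong {ℕ.zero}  eq = refl
  prodF-cong {ℕ.suc q} eq = *-cong (eq zero) (prodF-cong (eq ∘ suc))

  prodF-comm : ∀ {q s} (f : Fin q → Fin s → Carrier) →
               prodF K (λ i → prodF K (f i)) ≈ prodF K (λ j → prodF K (λ i → f i j))
  prodF-comm f = begin
    prodF K (λ i → prodF K (f i))           ≡⟨ prodF≡∏ (λ i → prodF K (f i)) ⟩
    ∏ (λ i → prodF K (f i))                 ≡⟨ ∏.sum-cong-≗ (prodF≡∏ ∘ f) ⟩
    ∏ (λ i → ∏ (f i))                       ≈⟨ ∏.∑-comm f ⟩
    ∏ (λ j → ∏ (λ i → f i j))               ≡⟨ ∏.sum-cong-≗ (λ j → prodF≡∏ (λ i → f i j)) ⟨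
    ∏ (λ j → prodF K (λ i → f i j))         ≡⟨ prodF≡∏ (λ j → prodF K (λ i → f i j)) ⟨
    prodF K (λ j → prodF K (λ i → f i j))   ∎
    where open ≈-Reasoning

  prodF-if-0 : ∀ {q} (b : Fin q → Bool) (f : Fin q → Carrier) →
               prodF K (λ i → if b i then f i else 0#) ≈ (if allF b then prodF K f else 0#)
  prodF-if-0 {ℕ.zero}  b f = refl
  prodF-if-0 {ℕ.suc q} b f = trans (*-congˡ (prodF-if-0 (b ∘ suc) (f ∘ suc))) (if-0-* (b zero) (allF (b ∘ suc)))
    where
    if-0-* : ∀ c d {x y} → (if c then x else 0#) * (if d then y else 0#) ≈ (if c ∧ d then x * y else 0#)
    if-0-* true  true  = refl
    if-0-* true  false = zeroʳ _
    if-0-* false d     = zeroˡ _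

  prodF-if-1 : ∀ {q} (b : Fin q → Bool) w → prodF K (λ i → if b i then w else 1#) ≈ _^_ K w (count b)
  prodF-if-1 {ℕ.zero}  b w = refl
  prodF-if-1 {ℕ.suc q} b w with b zero
  ... | true  = *-congˡ (prodF-if-1 (b ∘ suc) w)
  ... | false = trans (*-identityˡ _) (prodF-if-1 (b ∘ suc) w)

  fromℕ-length-filter : ∀ {A : Set} (p : A → Bool) (xs : List A) →
                        fromℕ cring (length (filter (λ a → p a Data.Bool.≟ true) xs))
                          ≈ ∑ₗ xs (λ a → if p a then 1# else 0#)
  fromℕ-length-filter p []       = refl
  fromℕ-length-filter p (x ∷ xs) with p x
  ... | true  = +-congˡ (fromℕ-length-filter p xs)
  ... | false = trans (fromℕ-length-filter p xs) (sym (+-identityˡ _))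

  module _ {n} (N : Network K n) {r : ℕ} where

    isDimerWith : (Fin n → Bool) → (Fin (m N) → Bool) → Bool
    isDimerWith I π = isAPM K N π ∧ sameSet K N (∂ K N π) I

    -- Δ K N I unfolds to ∑ₗ (allFuns bools (m N)) (dimerTerm I).
    dimerTerm : (Fin n → Bool) → (Fin (m N) → Bool) → Carrier
    dimerTerm I π = if isDimerWith I π then wtM K N π else 0#

    isDimerWith-cong : ∀ I → isDimerWith I Preserves _≗_ ⟶ _≡_
    isDimerWith-cong I eq = cong₂ _∧_
      (cong₂ _∧_ (allF-cong λ w → cong (_==ℕ 1) (count-cong λ e → cong (_∧ atW K N w e) (eq e)))
        (cong₂ _∧_ (allF-cong λ b → cong (_==ℕ 1) (count-cong λ e → cong (_∧ atB K N b e) (eq e)))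
                   (allF-cong λ i → cong (λ c → ⌊ c ℕ.≤? 1 ⌋) (count-cong λ e → cong (_∧ atBd K N i e) (eq e)))))
      (allF-cong λ i → cong (λ b → ⌊ b Data.Bool.≟ I i ⌋) (anyF-cong λ e → cong (_∧ atBd K N i e) (eq e)))

    dimerTerm-cong : ∀ I → dimerTerm I Preserves _≗_ ⟶ _≈_
    dimerTerm-cong I {π} {π′} eq with isDimerWith I π | isDimerWith I π′ | isDimerWith-cong I eq
    ... | true  | .true  | ≡.refl = prodF-cong λ e → reflexive (cong (λ b → if b then wt N e else 1#) (eq e))
    ... | false | .false | ≡.refl = refl

    atBd-unique : ∀ j e e′ → T (atBd K N j e) → T (atBd K N j e′) → e ≡ e′
    atBd-unique j e e′ h h′ = bdry≤1 N j e e′ (atBd⇒black e h) (atBd⇒black e′ h′)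
      where
      atBd⇒black : ∀ e → T (atBd K N j e) → black N e ≡ inj₁ j
      atBd⇒black e h with black N e
      ... | inj₁ i = cong inj₁ (toWitness h)

    count-atBd : ∀ j (p : Fin (m N) → Bool) → (∀ e → T (p e) → T (atBd K N j e)) →
                 count p ≡ (if anyF p then 1 else 0)
    count-atBd j p p⇒atBd = count-atMostOne p λ e e′ h h′ → atBd-unique j e e′ (p⇒atBd e h) (p⇒atBd e′ h′)

    boundary-atMostOne : ∀ (π : Fin (m N) → Bool) →
                         allF (λ i → ⌊ count (λ e → π e ∧ atBd K N i e) ℕ.≤? 1 ⌋) ≡ true
    boundary-atMostOne π = to T-≡ (from T-allF λ i → fromWitness (count≤1 i))
      where
      count≤1 : ∀ i → count (λ e → π e ∧ atBd K N i e) ≤ 1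
      count≤1 i rewrite count-atBd i (λ e → π e ∧ atBd K N i e) (λ e → proj₂ ∘ to T-∧)
        with anyF (λ e → π e ∧ atBd K N i e)
      ... | true  = s≤s z≤n
      ... | false = z≤n

    isWebOfDegree : (Fin n → ℕ) → (Fin (m N) → Fin (ℕ.suc r)) → Bool
    isWebOfDegree λ' μ = isWeb K N r μ ∧ allF (λ j → degW K N r μ j ==ℕ λ' j)

    prodF-wtM-columns : ∀ {μ : Fin (m N) → Fin (ℕ.suc r)} (L : Fin (m N) → Vec Bool r) →
                        (∀ e → card (L e) ≡ toℕ (μ e)) →
                        prodF K (λ x → wtM K N (column L x)) ≈ wtW K N r μ
    prodF-wtM-columns {μ} L card≡μ = begin
      prodF K (λ x → prodF K (λ e → if column L x e then wt N e else 1#))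
        ≈⟨ prodF-comm (λ x e → if column L x e then wt N e else 1#) ⟩
      prodF K (λ e → prodF K (λ x → if lookup (L e) x then wt N e else 1#))
        ≈⟨ prodF-cong (λ e → prodF-if-1 (lookup (L e)) (wt N e)) ⟩
      prodF K (λ e → _^_ K (wt N e) (card (L e)))
        ≈⟨ prodF-cong (λ e → reflexive (cong (_^_ K (wt N e)) (card≡μ e))) ⟩
      wtW K N r μ ∎
      where open ≈-Reasoning

    labelMultiplicity : (Fin (m N) → Vec Bool r) → Fin (m N) → Fin (ℕ.suc r)
    labelMultiplicity L e = fromℕ< (s≤s (count≤ (lookup (L e))))

    module _ (S : Fin n → Vec Bool r) where

      record IsLabeling (μ : Fin (m N) → Fin (ℕ.suc r)) (L : Fin (m N) → Vec Bool r) : Set where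
        field
          multiplicity : ∀ e → card (L e) ≡ toℕ (μ e)
          atWhite      : ∀ w x → count (λ e → atW K N w e ∧ column L x e) ≡ 1
          atBlack      : ∀ b x → count (λ e → atB K N b e ∧ column L x e) ≡ 1
          atBoundary   : ∀ j x → anyF (λ e → atBd K N j e ∧ column L x e) ≡ column S x j

      T-isLabeling : ∀ {μ L} → T (isLabeling K N r μ S L) → IsLabeling μ L
      T-isLabeling {μ} {L} h =
        let (hMult , h′)         = to (T-∧ {multOK}) h
            (hWhite , h″)        = to (T-∧ {whiteOK}) h′
            (hBlack , hBoundary) = to (T-∧ {blackOK}) h″
        in record
          { multiplicity = λ e → toWitness (to T-allF hMult e)
          ; atWhite      = λ w x → toWitness (to T-allF (to T-allF hWhite w) x)
          ; atBlack      = λ b x → toWitness (to T-allF (to T-allF hBlack b) x)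
          ; atBoundary   = λ j x → toWitness (to T-allF (to T-allF hBoundary j) x)
          }
        where
        multOK whiteOK blackOK : Bool
        multOK  = allF (λ e → card (L e) ==ℕ toℕ (μ e))
        whiteOK = allF (λ w → allF (λ x → count (λ e → atW K N w e ∧ column L x e) ==ℕ 1))
        blackOK = allF (λ b → allF (λ x → count (λ e → atB K N b e ∧ column L x e) ==ℕ 1))

      module _ {μ L} (lab : IsLabeling μ L) where
        open IsLabeling lab

        multiplicity-sum : ∀ (at : Fin (m N) → Bool) →
                           sumℕ (λ e → if at e then toℕ (μ e) else 0)
                             ≡ sumℕ (λ x → count (λ e → at e ∧ column L x e))
        multiplicity-sum at = begin
          sumℕ (λ e → if at e then toℕ (μ e) else 0)
            ≡⟨ sumℕ-cong (λ e → cong (λ k → if at e then k else 0) (≡.sym (multiplicity e))) ⟩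
          sumℕ (λ e → if at e then card (L e) else 0)
            ≡⟨ sumℕ-cong (λ e → count-∧ˡ (at e) (lookup (L e))) ⟨
          sumℕ (λ e → count (λ x → at e ∧ column L x e))
            ≡⟨ sum-count-comm (λ e x → at e ∧ column L x e) ⟩
          sumℕ (λ x → count (λ e → at e ∧ column L x e)) ∎
          where open ≡-Reasoning

        labeling⇒isWebOfDegree : ∀ λ' → (∀ j → card (S j) ≡ λ' j) → T (isWebOfDegree λ' μ)
        labeling⇒isWebOfDegree λ' card≡λ' =
          from T-∧ (from T-∧ (from T-allF balanced-white , from T-allF balanced-black) , from T-allF degree)
          where
          balanced : ∀ (at : Fin (m N) → Bool) → (∀ x → count (λ e → at e ∧ column L x e) ≡ 1) →
                     sumℕ (λ e → if at e then toℕ (μ e) else 0) ≡ r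
          balanced at once = ≡.trans (multiplicity-sum at) (≡.trans (sumℕ-cong once) (sumℕ-ones r))
          balanced-white : ∀ w → T (sumℕ (λ e → if atW K N w e then toℕ (μ e) else 0) ==ℕ r)
          balanced-white w = fromWitness (balanced (atW K N w) (atWhite w))
          balanced-black : ∀ b → T (sumℕ (λ e → if atB K N b e then toℕ (μ e) else 0) ==ℕ r)
          balanced-black b = fromWitness (balanced (atB K N b) (atBlack b))
          degree : ∀ j → T (degW K N r μ j ==ℕ λ' j)
          degree j = fromWitness (begin
            degW K N r μ j
              ≡⟨ multiplicity-sum (atBd K N j) ⟩
            sumℕ (λ x → count (atBdWith x))
              ≡⟨ sumℕ-cong (λ x → count-atBd j (atBdWith x) (λ e → proj₁ ∘ to T-∧)) ⟩
            sumℕ (λ x → if anyF (atBdWith x) then 1 else 0)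
              ≡⟨ sumℕ-cong (λ x → cong (λ b → if b then 1 else 0) (atBoundary j x)) ⟩
            sumℕ (λ x → if column S x j then 1 else 0)
              ≡⟨ count≡sumℕ (lookup (S j)) ⟨
            card (S j)
              ≡⟨ card≡λ' j ⟩
            λ' j ∎)
            where
            open ≡-Reasoning
            atBdWith : Fin r → Fin (m N) → Bool
            atBdWith x e = atBd K N j e ∧ column L x e

      isLabeling≡columnsAreDimers : ∀ {μ} L → (∀ e → card (L e) ≡ toℕ (μ e)) →
                                    isLabeling K N r μ S L ≡ allF (λ x → isDimerWith (column S x) (column L x))
      isLabeling≡columnsAreDimers {μ} L card≡μ = begin
        isLabeling K N r μ S L
          ≡⟨ cong₂ _∧_ multiplicities (cong₂ _∧_ (transpose (atW K N) (λ _ _ → count1) (λ _ _ → count1-cong))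
               (cong₂ _∧_ (transpose (atB K N) (λ _ _ → count1) (λ _ _ → count1-cong))
                          (transpose (atBd K N) (λ j x p → ⌊ anyF p Data.Bool.≟ column S x j ⌋)
                                     (λ j x eq → cong (λ b → ⌊ b Data.Bool.≟ column S x j ⌋) (anyF-cong eq))))) ⟩
        allF whiteOK ∧ (allF blackOK ∧ allF boundaryOK)
          ≡⟨ ≡.trans (allF-∧ whiteOK _) (cong (allF whiteOK ∧_) (allF-∧ blackOK boundaryOK)) ⟨
        allF (λ x → whiteOK x ∧ (blackOK x ∧ boundaryOK x))
          ≡⟨ allF-cong (λ x → regroup (whiteOK x) (blackOK x) (boundaryOK x) (boundary-atMostOne (column L x))) ⟩
        allF (λ x → isDimerWith (column S x) (column L x)) ∎
        where
        open ≡-Reasoning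
        multiplicities : allF (λ e → card (L e) ==ℕ toℕ (μ e)) ≡ true
        multiplicities = to T-≡ (from T-allF (λ e → fromWitness (card≡μ e)))
        count1 : (Fin (m N) → Bool) → Bool
        count1 p = count p ==ℕ 1
        count1-cong : count1 Preserves _≗_ ⟶ _≡_
        count1-cong eq = cong (_==ℕ 1) (count-cong eq)
        transpose : ∀ {s} (at : Fin s → Fin (m N) → Bool) (P : Fin s → Fin r → (Fin (m N) → Bool) → Bool) →
                    (∀ i x → P i x Preserves _≗_ ⟶ _≡_) →
                    allF (λ i → allF (λ x → P i x (λ e → at i e ∧ column L x e)))
                      ≡ allF (λ x → allF (λ i → P i x (λ e → column L x e ∧ at i e)))
        transpose at P P-cong = ≡.trans (allF-comm (λ i x → P i x (λ e → at i e ∧ column L x e)))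
          (allF-cong λ x → allF-cong λ i → P-cong i x (λ e → ∧-comm (at i e) (column L x e)))
        whiteOK blackOK boundaryOK : Fin r → Bool
        whiteOK x    = allF (λ w → count1 (λ e → column L x e ∧ atW K N w e))
        blackOK x    = allF (λ b → count1 (λ e → column L x e ∧ atB K N b e))
        boundaryOK x = sameSet K N (∂ K N (column L x)) (column S x)
        regroup : ∀ a b c {d} → d ≡ true → a ∧ (b ∧ c) ≡ (a ∧ (b ∧ d)) ∧ c
        regroup a b c ≡.refl =
          ≡.trans (cong (λ t → a ∧ (t ∧ c)) (≡.sym (∧-identityʳ b))) (≡.sym (∧-assoc a (b ∧ true) c))

      labeledWeight : (Fin (m N) → Fin (ℕ.suc r)) → (Fin (m N) → Vec Bool r) → Carrier
      labeledWeight μ L = if isLabeling K N r μ S L then sign K S * wtW K N r μ else 0#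

      -- A labeling determines the multiplicities of its web, so only μ = labelMultiplicity L contributes.
      ∑-labeledWeight : ∀ L → ∑ₗ (allFuns (allFin (ℕ.suc r)) (m N)) (λ μ → labeledWeight μ L)
                                ≈ sign K S * ∏ (λ x → dimerTerm (column S x) (column L x))
      ∑-labeledWeight L = ∑ₗ-allFuns-δ (m N) (λ μ → labeledWeight μ L) (labelMultiplicity L) at off
        where
        open ≈-Reasoning
        isDimer : Fin r → Bool
        isDimer x = isDimerWith (column S x) (column L x)
        at : ∀ μ → μ ≗ labelMultiplicity L →
             labeledWeight μ L ≈ sign K S * ∏ (λ x → dimerTerm (column S x) (column L x))
        at μ μ≗ = begin
          labeledWeight μ L
            ≡⟨ cong (λ b → if b then sign K S * wtW K N r μ else 0#) (isLabeling≡columnsAreDimers L card≡μ) ⟩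
          (if allF isDimer then sign K S * wtW K N r μ else 0#)
            ≈⟨ if-0-*ˡ (sign K S) _ (allF isDimer) ⟩
          sign K S * (if allF isDimer then wtW K N r μ else 0#)
            ≈⟨ *-congˡ (if-0-cong (allF isDimer) (prodF-wtM-columns L card≡μ)) ⟨
          sign K S * (if allF isDimer then prodF K (λ x → wtM K N (column L x)) else 0#)
            ≈⟨ *-congˡ (prodF-if-0 isDimer (λ x → wtM K N (column L x))) ⟨
          sign K S * prodF K (λ x → dimerTerm (column S x) (column L x))
            ≡⟨ cong (sign K S *_) (prodF≡∏ (λ x → dimerTerm (column S x) (column L x))) ⟩
          sign K S * ∏ (λ x → dimerTerm (column S x) (column L x)) ∎
          where
          card≡μ : ∀ e → card (L e) ≡ toℕ (μ e)
          card≡μ e = ≡.trans (≡.sym (toℕ-fromℕ< _)) (cong toℕ (≡.sym (μ≗ e)))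
        off : ∀ μ → ¬ μ ≗ labelMultiplicity L → labeledWeight μ L ≈ 0#
        off μ μ≇ with isLabeling K N r μ S L in eq
        ... | false = refl
        ... | true  = ⊥-elim (μ≇ λ e → toℕ-injective (≡.trans (≡.sym (multiplicity e)) (≡.sym (toℕ-fromℕ< _))))
          where open IsLabeling (T-isLabeling {μ} {L} (from T-≡ eq))

      webSummand≈∑labeledWeight :
        ∀ λ' → (∀ j → card (S j) ≡ λ' j) → ∀ μ →
        (if isWebOfDegree λ' μ then wtW K N r μ * (sign K S * fromℕ cring (aCount K N r μ S)) else 0#)
          ≈ ∑ₗ (allFuns (allSubsets r) (m N)) (labeledWeight μ)
      webSummand≈∑labeledWeight λ' card≡λ' μ with isWebOfDegree λ' μ in eq
      ... | true = begin
        wtW K N r μ * (sign K S * fromℕ cring (aCount K N r μ S))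
          ≈⟨ *-congˡ (*-congˡ (fromℕ-length-filter (isLabeling K N r μ S) labelings)) ⟩
        wtW K N r μ * (sign K S * ∑ₗ labelings isLabeled)
          ≈⟨ trans (sym (*-assoc _ _ _)) (*-congʳ (*-comm _ _)) ⟩
        (sign K S * wtW K N r μ) * ∑ₗ labelings isLabeled
          ≈⟨ *-distribˡ-∑ₗ _ labelings isLabeled ⟩
        ∑ₗ labelings (λ L → (sign K S * wtW K N r μ) * isLabeled L)
          ≈⟨ ∑ₗ-cong labelings (λ L → *-if-1-0 _ (isLabeling K N r μ S L)) ⟩
        ∑ₗ labelings (labeledWeight μ) ∎
        where
        open ≈-Reasoning
        labelings : List (Fin (m N) → Vec Bool r)
        labelings = allFuns (allSubsets r) (m N)
        isLabeled : (Fin (m N) → Vec Bool r) → Carrier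
        isLabeled L = if isLabeling K N r μ S L then 1# else 0#
      ... | false = sym (∑ₗ-zero (allFuns (allSubsets r) (m N)) unlabeled)
        where
        unlabeled : ∀ L → labeledWeight μ L ≈ 0#
        unlabeled L with isLabeling K N r μ S L in eqL
        ... | false = refl
        ... | true  = ⊥-elim (subst T eq (labeling⇒isWebOfDegree (T-isLabeling {μ} {L} (from T-≡ eqL)) λ' card≡λ'))

      WebAt-factorises : ∀ λ' → (∀ j → card (S j) ≡ λ' j) →
                         WebAt K N r λ' S ≈ sign K S * prodF K (λ x → Δ K N (column S x))
      WebAt-factorises λ' card≡λ' = begin
        WebAt K N r λ' S
          ≈⟨ ∑ₗ-cong webs (webSummand≈∑labeledWeight λ' card≡λ') ⟩
        ∑ₗ webs (λ μ → ∑ₗ labelings (labeledWeight μ))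
          ≈⟨ ∑ₗ-comm webs labelings labeledWeight ⟩
        ∑ₗ labelings (λ L → ∑ₗ webs (λ μ → labeledWeight μ L))
          ≈⟨ ∑ₗ-cong labelings ∑-labeledWeight ⟩
        ∑ₗ labelings (λ L → sign K S * ∏ (λ x → dimerTerm (column S x) (column L x)))
          ≈⟨ *-distribˡ-∑ₗ (sign K S) labelings _ ⟨
        sign K S * ∑ₗ labelings (λ L → ∏ (λ x → dimerTerm (column S x) (column L x)))
          ≈⟨ *-congˡ (∑ₗ-allFuns-columns r (m N) (dimerTerm ∘ column S) (dimerTerm-cong ∘ column S)) ⟩
        sign K S * ∏ (λ x → Δ K N (column S x))
          ≡⟨ cong (sign K S *_) (prodF≡∏ (λ x → Δ K N (column S x))) ⟨
        sign K S * prodF K (λ x → Δ K N (column S x)) ∎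
        where
        open ≈-Reasoning
        webs : List (Fin (m N) → Fin (ℕ.suc r))
        webs = allFuns (allFin (ℕ.suc r)) (m N)
        labelings : List (Fin (m N) → Vec Bool r)
        labelings = allFuns (allSubsets r) (m N)

-- Opened only here: above, _+_ and _*_ are the ring operations.
open import Data.Nat using (_+_; _*_)

theorem4p4 : (K : ACF0) (r n k : ℕ) → 1 ≤ r →
    (N N' : Network K n) →
    nW N ≡ k + nB N → nW N' ≡ k + nB N' →
    HasAPM K N → HasAPM K N' →
    (λ' : Fin n → ℕ) → (∀ i → λ' i ≤ r) → sumℕ λ' ≡ k * r →
    (∀ (I : Fin n → Bool) → count I ≡ k → ACF0._≈_ K (Δ K N I) (Δ K N' I)) →
    ∀ (S : Fin n → Vec Bool r) → IsType K k λ' S →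
    ACF0._≈_ K (WebAt K N r λ' S) (WebAt K N' r λ' S)
theorem4p4 K r n k _ N N' _ _ _ _ λ' _ _ Δ≈ S (card≡λ' , columns≡k) =
  trans (WebAt-factorises K N S λ' card≡λ')
        (trans (*-congˡ (prodF-cong K λ x → Δ≈ (column S x) (columns≡k x)))
               (sym (WebAt-factorises K N' S λ' card≡λ')))
  where open ACF0 K using (trans; sym; *-congˡ)
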